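{- Let $\mathcal K = (S, A, R, I, AP, \ell)$ be a labeled Kripke structure, $s \in S$, and $\varphi$ a closed $\mu$-calculus formula. Then for any valuations $\eta$ and $\xi$, $s \in [\![\varphi]\!]_{\mathcal K, \eta}$ if and only if $\Gamma_{\mathcal K, s} \in \langle\!\langle \varphi \rangle\!\rangle_{\mathcal K, \xi}$.
   Context: Executions are words $s_0 a_1 s_1 a_2 \cdots$ (finite or infinite) with $s_k \to^{a_{k+1}} s_{k+1}$; $\Gamma_{\mathcal K}$ is the set of all executions and $\Gamma_{\mathcal K,s}$ those starting at $s$. For a set $T$ of executions and a finite word $w$ ending in a state $s$, $T/w = \{ s\rho : w\rho \in T\}$. $\mu$-calculus formulae: $\varphi ::= \bot \mid \top \mid p \mid Z \mid \neg\varphi \mid \varphi\wedge\varphi \mid \varphi\vee\varphi \mid [a]\varphi \mid \langle a\rangle\varphi \mid \mu Z.\varphi \mid \nu Z.\varphi$, with every bound variable under an even number of negations. The classical semantics $[\![\varphi]\!]_{\mathcal K,\eta} \subseteq S$ (with $\eta$ assigning subsets of $S$ to variables) is the standard one: $[\![p]\!] = \{s : p \in \ell(s)\}$, $[\![\langle a\rangle\varphi]\!] = \{ s : \exists s',\ s\to^a s',\ s' \in [\![\varphi]\!]\}$, fixpoints as greatest/least fixpoints, etc. The strategy semantics $\langle\!\langle\varphi\rangle\!\rangle_{\mathcal K,\xi} \subseteq \mathcal P(\Gamma_{\mathcal K})$, with $\xi : \mathrm{Var} \to \mathcal P(\mathcal P(\Gamma_{\mathcal K}))$: $\langle\!\langle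 p\rangle\!\rangle = \{T \subseteq \Gamma_{\mathcal K} : \forall \pi \in T,\ p \in \ell(\pi_0)\}$; $\langle\!\langle \neg\varphi\rangle\!\rangle = \mathcal P(\Gamma_{\mathcal K}) \setminus \langle\!\langle\varphi\rangle\!\rangle$; $\langle\!\langle \varphi_1\wedge\varphi_2\rangle\!\rangle = \langle\!\langle\varphi_1\rangle\!\rangle \cap \langle\!\langle\varphi_2\rangle\!\rangle$; $\langle\!\langle Z\rangle\!\rangle_\xi = \xi(Z)$; $\langle\!\langle \langle a\rangle\varphi\rangle\!\rangle = \{T : \exists\, s a \pi \in T,\ T/(s a \pi_0) \in \langle\!\langle\varphi\rangle\!\rangle\}$; $\langle\!\langle [a]\varphi\rangle\!\rangle = \{T : \forall\, s a \pi \in T,\ T/(s a \pi_0) \in \langle\!\langle\varphi\rangle\!\rangle\}$; $\langle\!\langle \nu Z.\varphi\rangle\!\rangle_\xi = \bigcup\{F \subseteq \mathcal P(\Gamma_{\mathcal K}) : F \subseteq \langle\!\langle\varphi\rangle\!\rangle_{\xi[Z/F]}\}$; $\langle\!\langle \mu Z.\varphi\rangle\!\rangle_\xi = \bigcap\{F \subseteq \mathcal P(\Gamma_{\mathcal K}) : \langle\!\langle\varphi\rangle\!\rangle_{\xi[Z/F]} \subseteq F\}$; other connectives by the usual equivalences. Here $\xi[Z/F]$ is $\xi$ with $Z$ mapped to $F$. -}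

module Defs where

open import Level using (Level; Lift; lift) renaming (suc to lsuc; zero to lzero)
open import Data.Nat using (ℕ; zero; suc; _≟_)
open import Data.Bool using (Bool; true; false; not; if_then_else_)
open import Data.List using (List; []; _∷_)
open import Data.Product using (Σ; _×_; _,_; proj₁; proj₂)
open import Data.Sum using (_⊎_)
open import Data.Empty using (⊥)
open import Data.Unit using (⊤)
open import Relation.Nullary using (¬_; does)
open import Relation.Binary.PropositionalEquality using (_≡_; _≢_)

record Kripke : Set₁ where
  field
    S  : Set
    A  : Set
    R  : S → A → S → Set
    I  : S → Set
    AP : Set
    ℓ  : S → AP → Set

Var : Set
Var = ℕ

data Formula (Act Prop : Set) : Set where
  bot top : Formula Act Prop
  atom    : Prop → Formula Act Prop
  var     : Var → Formula Act Prop
  ¬ᶠ_     : Formula Act Prop → Formula Act Prop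
  _∧ᶠ_ _∨ᶠ_ : Formula Act Prop → Formula Act Prop → Formula Act Prop
  [_]ᶠ_ ⟨_⟩ᶠ_ : Act → Formula Act Prop → Formula Act Prop
  μᶠ νᶠ   : Var → Formula Act Prop → Formula Act Prop

module _ {Act Prop : Set} where

  -- Occ b Z φ : Z has a free occurrence in φ lying under an even (b = true)
  -- resp. odd (b = false) number of negations.
  data Occ : Bool → Var → Formula Act Prop → Set where
    o-var : ∀ {Z} → Occ true Z (var Z)
    o-neg : ∀ {b Z φ} → Occ b Z φ → Occ (not b) Z (¬ᶠ φ)
    o-∧l  : ∀ {b Z φ ψ} → Occ b Z φ → Occ b Z (φ ∧ᶠ ψ)
    o-∧r  : ∀ {b Z φ ψ} → Occ b Z ψ → Occ b Z (φ ∧ᶠ ψ)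
    o-∨l  : ∀ {b Z φ ψ} → Occ b Z φ → Occ b Z (φ ∨ᶠ ψ)
    o-∨r  : ∀ {b Z φ ψ} → Occ b Z ψ → Occ b Z (φ ∨ᶠ ψ)
    o-box : ∀ {b Z a φ} → Occ b Z φ → Occ b Z ([ a ]ᶠ φ)
    o-dia : ∀ {b Z a φ} → Occ b Z φ → Occ b Z (⟨ a ⟩ᶠ φ)
    o-μ   : ∀ {b Z Y φ} → Z ≢ Y → Occ b Z φ → Occ b Z (μᶠ Y φ)
    o-ν   : ∀ {b Z Y φ} → Z ≢ Y → Occ b Z φ → Occ b Z (νᶠ Y φ)

  Closed : Formula Act Prop → Set
  Closed φ = ∀ b Z → ¬ Occ b Z φ

  WF : Formula Act Prop → Set
  WF bot = ⊤
  WF top = ⊤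
  WF (atom p) = ⊤
  WF (var Z) = ⊤
  WF (¬ᶠ φ) = WF φ
  WF (φ ∧ᶠ ψ) = WF φ × WF ψ
  WF (φ ∨ᶠ ψ) = WF φ × WF ψ
  WF ([ a ]ᶠ φ) = WF φ
  WF (⟨ a ⟩ᶠ φ) = WF φ
  WF (μᶠ Z φ) = WF φ × ¬ Occ false Z φ
  WF (νᶠ Z φ) = WF φ × ¬ Occ false Z φ

_[_↦_] : ∀ {a} {X : Set a} → (Var → X) → Var → X → (Var → X)
(f [ Z ↦ x ]) Y = if does (Z ≟ Y) then x else f Y

module _ (K : Kripke) where
  open Kripke K

  Env : Set₁
  Env = Var → (S → Set)

  ⟦_⟧ : Formula A AP → Env → S → Set₁
  ⟦ bot ⟧ η s = Lift (lsuc lzero) ⊥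
  ⟦ top ⟧ η s = Lift (lsuc lzero) ⊤
  ⟦ atom p ⟧ η s = Lift (lsuc lzero) (ℓ s p)
  ⟦ var Z ⟧ η s = Lift (lsuc lzero) (η Z s)
  ⟦ ¬ᶠ φ ⟧ η s = ¬ ⟦ φ ⟧ η s
  ⟦ φ ∧ᶠ ψ ⟧ η s = ⟦ φ ⟧ η s × ⟦ ψ ⟧ η s
  ⟦ φ ∨ᶠ ψ ⟧ η s = ⟦ φ ⟧ η s ⊎ ⟦ ψ ⟧ η s
  ⟦ [ a ]ᶠ φ ⟧ η s = ∀ s' → R s a s' → ⟦ φ ⟧ η s'
  ⟦ ⟨ a ⟩ᶠ φ ⟧ η s = Σ S λ s' → Lift (lsuc lzero) (R s a s') × ⟦ φ ⟧ η s'
  -- greatest fixpoint: union of all post-fixed points G ⊆ ⟦φ⟧[Z/G]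
  ⟦ νᶠ Z φ ⟧ η s = Σ (S → Set) λ G → (∀ t → G t → ⟦ φ ⟧ (η [ Z ↦ G ]) t) × Lift (lsuc lzero) (G s)
  -- least fixpoint: intersection of all pre-fixed points ⟦φ⟧[Z/G] ⊆ G
  ⟦ μᶠ Z φ ⟧ η s = ∀ (G : S → Set) → (∀ t → ⟦ φ ⟧ (η [ Z ↦ G ]) t → G t) → G s

  data Word : Set where
    fin : S → List (A × S) → Word          -- s0 (a1,s1) ... (an,sn)
    inf : S → (ℕ → A × S) → Word           -- s0 (a1,s1) (a2,s2) ...

  head : Word → S
  head (fin s _) = s
  head (inf s _) = s

  cons : S → A → Word → Word
  cons s a (fin s' l) = fin s ((a , s') ∷ l)
  cons s a (inf s' f) = inf s g
    where
      g : ℕ → A × S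
      g zero = (a , s')
      g (suc n) = f n

  ValidList : S → List (A × S) → Set
  ValidList s [] = ⊤
  ValidList s ((a , s') ∷ l) = R s a s' × ValidList s' l

  infState : S → (ℕ → A × S) → ℕ → S
  infState s f zero = s
  infState s f (suc n) = proj₂ (f n)

  Valid : Word → Set
  Valid (fin s l) = ValidList s l
  Valid (inf s f) = ∀ n → R (infState s f n) (proj₁ (f n)) (proj₂ (f n))

  PW : Set₁
  PW = Word → Set

  _⊆Γ : PW → Set
  T ⊆Γ = ∀ w → T w → Valid w

  _≐_ : PW → PW → Set
  T ≐ T' = ∀ w → (T w → T' w) × (T' w → T w)

  Γ : S → PW
  Γ s w = Valid w × head w ≡ s

  -- T/(s a s') = { s'ρ : s a s' ρ ∈ T }
  _/⟨_,_,_⟩ : PW → S → A → S → PW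
  (T /⟨ s , a , s' ⟩) ρ = head ρ ≡ s' × T (cons s a ρ)

  -- an element of P(P(Γ_K)): a set of sets of executions
  -- (membership respects extensional equality of sets, as sets do)
  record Fam : Set₁ where
    field
      _∋_  : PW → Set
      ext : ∀ {T T'} → T ≐ T' → _∋_ T → _∋_ T'
      sub : ∀ {T} → _∋_ T → T ⊆Γ
  open Fam public

  SEnv : Set₁
  SEnv = Var → Fam

  ⟪_⟫ : Formula A AP → SEnv → PW → Set₁
  ⟪ bot ⟫ ξ T = Lift (lsuc lzero) ⊥
  ⟪ top ⟫ ξ T = Lift (lsuc lzero) (T ⊆Γ)
  ⟪ atom p ⟫ ξ T = Lift (lsuc lzero) (T ⊆Γ × (∀ π → T π → ℓ (head π) p))
  ⟪ var Z ⟫ ξ T = Lift (lsuc lzero) ((ξ Z) ∋ T)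
  ⟪ ¬ᶠ φ ⟫ ξ T = Lift (lsuc lzero) (T ⊆Γ) × ¬ ⟪ φ ⟫ ξ T
  ⟪ φ ∧ᶠ ψ ⟫ ξ T = ⟪ φ ⟫ ξ T × ⟪ ψ ⟫ ξ T
  ⟪ φ ∨ᶠ ψ ⟫ ξ T = ⟪ φ ⟫ ξ T ⊎ ⟪ ψ ⟫ ξ T
  ⟪ ⟨ a ⟩ᶠ φ ⟫ ξ T =
    Lift (lsuc lzero) (T ⊆Γ) × (Σ S λ s → Σ Word λ π → Lift (lsuc lzero) (T (cons s a π)) × ⟪ φ ⟫ ξ (T /⟨ s , a , head π ⟩))
  ⟪ [ a ]ᶠ φ ⟫ ξ T =
    Lift (lsuc lzero) (T ⊆Γ) × (∀ s π → T (cons s a π) → ⟪ φ ⟫ ξ (T /⟨ s , a , head π ⟩))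
  ⟪ νᶠ Z φ ⟫ ξ T = Σ Fam λ F → (∀ T' → F ∋ T' → ⟪ φ ⟫ (ξ [ Z ↦ F ]) T') × Lift (lsuc lzero) (F ∋ T)
  ⟪ μᶠ Z φ ⟫ ξ T = ∀ (F : Fam) → (∀ T' → ⟪ φ ⟫ (ξ [ Z ↦ F ]) T' → F ∋ T') → F ∋ T

{-# OPTIONS --safe #-}
-- Every strategy set is a
-- set of executions, is invariant under extensional equality, and the residual of
-- Γ_{K,s} along a transition s →ᵃ s' is Γ_{K,s'}; so on the sets Γ_{K,s} the strategy
-- clauses for atoms, connectives and modalities reduce to the classical ones.  For the
-- fixpoints, a set G ⊆ S and a family F ⊆ P(Γ_K) are matched when t ∈ G ⇔ Γ_{K,t} ∈ F:
-- every F is matched by its trace, and every G by a smallest and a largest family, which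
-- transport post- resp. pre-fixed points in the direction the fixpoint clauses need.
module Submission where

open import Defs
open import Data.List using ([])
open import Data.Nat using (zero; suc; _≟_)
open import Data.Product using (Σ; _×_; _,_; proj₁; proj₂)
open import Data.Product.Function.NonDependent.Propositional using (_×-⇔_)
open import Data.Sum using (inj₁; inj₂)
open import Data.Sum.Function.Propositional using (_⊎-⇔_)
open import Data.Empty using (⊥-elim)
open import Data.Unit using (tt)
open import Function.Bundles using (_⇔_; mk⇔; Equivalence)
open import Function.Construct.Identity using (⇔-id)
open import Level using (lift)
open import Relation.Nullary using (yes; no)
open import Relation.Nullary.Decidable using (dec-true; dec-false)
open import Relation.Binary.PropositionalEquality using (_≡_; _≢_; refl; sym; trans; subst)

module Correspondence (K : Kripke) where
  open Kripke K
  open Equivalence using (to; from)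

  infix 4 _≈_
  _≈_ : PW K → PW K → Set
  _≈_ = _≐_ K

  ≈-refl : ∀ {T} → T ≈ T
  ≈-refl w = (λ x → x) , (λ x → x)

  ≈-sym : ∀ {T T'} → T ≈ T' → T' ≈ T
  ≈-sym e w = proj₂ (e w) , proj₁ (e w)

  ≈-trans : ∀ {T T' T''} → T ≈ T' → T' ≈ T'' → T ≈ T''
  ≈-trans e f w = (λ x → proj₁ (f w) (proj₁ (e w) x)) , (λ x → proj₂ (e w) (proj₂ (f w) x))

  ⊆Γ-resp-≈ : ∀ {T T'} → T ≈ T' → _⊆Γ K T → _⊆Γ K T'
  ⊆Γ-resp-≈ e T⊆Γ w x = T⊆Γ w (proj₂ (e w) x)

  /-resp-≈ : ∀ {T T'} {s a s'} → T ≈ T' → _/⟨_,_,_⟩ K T s a s' ≈ _/⟨_,_,_⟩ K T' s a s'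
  /-resp-≈ e ρ = (λ (h , x) → h , proj₁ (e _) x) , (λ (h , x) → h , proj₂ (e _) x)

  head-cons : ∀ s a π → head K (cons K s a π) ≡ s
  head-cons s a (fin _ _) = refl
  head-cons s a (inf _ _) = refl

  Valid-cons : ∀ s a π → Valid K (cons K s a π) ⇔ (R s a (head K π) × Valid K π)
  Valid-cons s a (fin _ _) = ⇔-id _
  Valid-cons s a (inf _ _) = mk⇔
    (λ v → v zero , λ { zero → v (suc zero) ; (suc n) → v (suc (suc n)) })
    (λ { (r , v) zero → r ; (r , v) (suc zero) → v zero ; (r , v) (suc (suc n)) → v (suc n) })

  Γ⊆Γ : ∀ s → _⊆Γ K (Γ K s)
  Γ⊆Γ s w (v , _) = v

  Γ-injective : ∀ {s t} → Γ K s ≈ Γ K t → s ≡ t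
  Γ-injective {s} e = proj₂ (proj₁ (e (fin s [])) (tt , refl))

  Γ-step : ∀ {s a s'} → R s a s' → Γ K s (cons K s a (fin s' []))
  Γ-step r = (r , tt) , refl

  Γ-residual : ∀ {s a s'} → R s a s' → _/⟨_,_,_⟩ K (Γ K s) s a s' ≈ Γ K s'
  Γ-residual {s} {a} r ρ =
    (λ (h , v , _) → proj₂ (to (Valid-cons s a ρ) v) , h) ,
    (λ (v , h) → h , from (Valid-cons s a ρ) (subst (R s a) (sym h) r , v) , head-cons s a ρ)

  Γ-residual-cons : ∀ {s} s₀ a π → Γ K s (cons K s₀ a π) →
                    R s a (head K π) × _/⟨_,_,_⟩ K (Γ K s) s₀ a (head K π) ≈ Γ K (head K π)
  Γ-residual-cons s₀ a π (v , h) =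
    residual (trans (sym (head-cons s₀ a π)) h) (proj₁ (to (Valid-cons s₀ a π) v))
    where
      residual : ∀ {s s'} → s₀ ≡ s → R s₀ a s' → R s a s' × _/⟨_,_,_⟩ K (Γ K s) s₀ a s' ≈ Γ K s'
      residual refl r = r , Γ-residual r

  ⟪⟫-resp-≈ : ∀ φ {ξ T T'} → T ≈ T' → ⟪ K ⟫ φ ξ T → ⟪ K ⟫ φ ξ T'
  ⟪⟫-resp-≈ bot e (lift ())
  ⟪⟫-resp-≈ top e (lift T⊆Γ) = lift (⊆Γ-resp-≈ e T⊆Γ)
  ⟪⟫-resp-≈ (atom p) e (lift (T⊆Γ , Tp)) = lift (⊆Γ-resp-≈ e T⊆Γ , λ w x → Tp w (proj₂ (e w) x))
  ⟪⟫-resp-≈ (var Z) {ξ} e (lift m) = lift (ext (ξ Z) e m)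
  ⟪⟫-resp-≈ (¬ᶠ φ) e (lift T⊆Γ , ¬Tφ) =
    lift (⊆Γ-resp-≈ e T⊆Γ) , λ T'φ → ¬Tφ (⟪⟫-resp-≈ φ (≈-sym e) T'φ)
  ⟪⟫-resp-≈ (φ ∧ᶠ ψ) e (Tφ , Tψ) = ⟪⟫-resp-≈ φ e Tφ , ⟪⟫-resp-≈ ψ e Tψ
  ⟪⟫-resp-≈ (φ ∨ᶠ ψ) e (inj₁ Tφ) = inj₁ (⟪⟫-resp-≈ φ e Tφ)
  ⟪⟫-resp-≈ (φ ∨ᶠ ψ) e (inj₂ Tψ) = inj₂ (⟪⟫-resp-≈ ψ e Tψ)
  ⟪⟫-resp-≈ ([ a ]ᶠ φ) e (lift T⊆Γ , all) =
    lift (⊆Γ-resp-≈ e T⊆Γ) , λ s π t → ⟪⟫-resp-≈ φ (/-resp-≈ e) (all s π (proj₂ (e _) t))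
  ⟪⟫-resp-≈ (⟨ a ⟩ᶠ φ) e (lift T⊆Γ , s , π , lift t , Tφ) =
    lift (⊆Γ-resp-≈ e T⊆Γ) , s , π , lift (proj₁ (e _) t) , ⟪⟫-resp-≈ φ (/-resp-≈ e) Tφ
  ⟪⟫-resp-≈ (μᶠ Z φ) e Tμ F pre = ext F e (Tμ F pre)
  ⟪⟫-resp-≈ (νᶠ Z φ) e (F , post , lift m) = F , post , lift (ext F e m)

  executionSets : Fam K
  executionSets = record { _∋_ = _⊆Γ K ; ext = ⊆Γ-resp-≈ ; sub = λ T⊆Γ → T⊆Γ }

  ⟪⟫⊆Γ : ∀ φ {ξ T} → ⟪ K ⟫ φ ξ T → _⊆Γ K T
  ⟪⟫⊆Γ bot (lift ())
  ⟪⟫⊆Γ top (lift T⊆Γ) = T⊆Γ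
  ⟪⟫⊆Γ (atom p) (lift (T⊆Γ , _)) = T⊆Γ
  ⟪⟫⊆Γ (var Z) {ξ} (lift m) = sub (ξ Z) m
  ⟪⟫⊆Γ (¬ᶠ φ) (lift T⊆Γ , _) = T⊆Γ
  ⟪⟫⊆Γ (φ ∧ᶠ ψ) (Tφ , _) = ⟪⟫⊆Γ φ Tφ
  ⟪⟫⊆Γ (φ ∨ᶠ ψ) (inj₁ Tφ) = ⟪⟫⊆Γ φ Tφ
  ⟪⟫⊆Γ (φ ∨ᶠ ψ) (inj₂ Tψ) = ⟪⟫⊆Γ ψ Tψ
  ⟪⟫⊆Γ ([ a ]ᶠ φ) (lift T⊆Γ , _) = T⊆Γ
  ⟪⟫⊆Γ (⟨ a ⟩ᶠ φ) (lift T⊆Γ , _) = T⊆Γ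
  ⟪⟫⊆Γ (μᶠ Z φ) Tμ = Tμ executionSets (λ T' → ⟪⟫⊆Γ φ)
  ⟪⟫⊆Γ (νᶠ Z φ) (F , _ , lift m) = sub F m

  Corresponds : (S → Set) → Fam K → Set
  Corresponds G F = ∀ t → G t ⇔ (F ∋ Γ K t)

  trace : Fam K → S → Set
  trace F t = F ∋ Γ K t

  trace-corresponds : ∀ F → Corresponds (trace F) F
  trace-corresponds F t = ⇔-id _

  smallestFam : (S → Set) → Fam K
  smallestFam G = record
    { _∋_ = λ T → Σ S λ t → G t × T ≈ Γ K t
    ; ext = λ e (t , g , e') → t , g , ≈-trans (≈-sym e) e'
    ; sub = λ (t , _ , e) → ⊆Γ-resp-≈ (≈-sym e) (Γ⊆Γ t)
    }

  largestFam : (S → Set) → Fam K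
  largestFam G = record
    { _∋_ = λ T → _⊆Γ K T × (∀ t → T ≈ Γ K t → G t)
    ; ext = λ e (T⊆Γ , g) → ⊆Γ-resp-≈ e T⊆Γ , λ t e' → g t (≈-trans e e')
    ; sub = proj₁
    }

  smallestFam-corresponds : ∀ G → Corresponds G (smallestFam G)
  smallestFam-corresponds G t = mk⇔
    (λ g → t , g , ≈-refl)
    (λ (t' , g , e) → subst G (sym (Γ-injective e)) g)

  largestFam-corresponds : ∀ G → Corresponds G (largestFam G)
  largestFam-corresponds G t = mk⇔
    (λ g → Γ⊆Γ t , λ t' e → subst G (Γ-injective e) g)
    (λ (_ , g) → g t ≈-refl)

  EnvAgree : Formula A AP → Env K → SEnv K → Set
  EnvAgree φ η ξ = ∀ {b Z} → Occ b Z φ → Corresponds (η Z) (ξ Z)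

  EnvAgree-update : ∀ {Y ψ η ξ G F} → (∀ {b Z} → Z ≢ Y → Occ b Z ψ → Corresponds (η Z) (ξ Z)) →
                    Corresponds G F → EnvAgree ψ (η [ Y ↦ G ]) (ξ [ Y ↦ F ])
  EnvAgree-update {Y} agree G∼F {Z = Z} o with Y ≟ Z
  ... | yes refl rewrite dec-true (Y ≟ Y) refl = G∼F
  ... | no Y≢Z rewrite dec-false (Y ≟ Z) Y≢Z = agree (λ Z≡Y → Y≢Z (sym Z≡Y)) o

  SemAgree : Formula A AP → Env K → SEnv K → Set₁
  SemAgree φ η ξ = ∀ s → ⟦ K ⟧ φ η s ⇔ ⟪ K ⟫ φ ξ (Γ K s)

  box-agree : ∀ {a ψ η ξ} → SemAgree ψ η ξ → SemAgree ([ a ]ᶠ ψ) η ξ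
  box-agree {a} {ψ} IH s = mk⇔
    (λ sψ → lift (Γ⊆Γ s) , λ s₀ π t →
       let r , e = Γ-residual-cons s₀ a π t
       in  ⟪⟫-resp-≈ ψ (≈-sym e) (to (IH (head K π)) (sψ (head K π) r)))
    (λ (_ , all) s' r → from (IH s') (⟪⟫-resp-≈ ψ (Γ-residual r) (all s (fin s' []) (Γ-step r))))

  diamond-agree : ∀ {a ψ η ξ} → SemAgree ψ η ξ → SemAgree (⟨ a ⟩ᶠ ψ) η ξ
  diamond-agree {a} {ψ} IH s = mk⇔
    (λ (s' , lift r , s'ψ) → lift (Γ⊆Γ s) , s , fin s' [] , lift (Γ-step r) ,
       ⟪⟫-resp-≈ ψ (≈-sym (Γ-residual r)) (to (IH s') s'ψ))
    (λ (_ , s₀ , π , lift t , Tψ) →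
       let r , e = Γ-residual-cons s₀ a π t
       in  head K π , lift r , from (IH (head K π)) (⟪⟫-resp-≈ ψ e Tψ))

  BodyAgree : Var → Formula A AP → Env K → SEnv K → Set₁
  BodyAgree Y ψ η ξ = ∀ {G F} → Corresponds G F → SemAgree ψ (η [ Y ↦ G ]) (ξ [ Y ↦ F ])

  μ-agree : ∀ {Y ψ η ξ} → BodyAgree Y ψ η ξ → SemAgree (μᶠ Y ψ) η ξ
  μ-agree {Y} {ψ} {η} {ξ} IH s = mk⇔
    (λ sμ F pre → sμ (trace F) λ t tψ → pre (Γ K t) (to (IH (trace-corresponds F) t) tψ))
    (λ Γμ G pre → from (largestFam-corresponds G s) (Γμ (largestFam G) (largestFam-pre G pre)))
    where
      largestFam-pre : ∀ G → (∀ t → ⟦ K ⟧ ψ (η [ Y ↦ G ]) t → G t) →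
                       ∀ T → ⟪ K ⟫ ψ (ξ [ Y ↦ largestFam G ]) T → largestFam G ∋ T
      largestFam-pre G pre T Tψ = ⟪⟫⊆Γ ψ Tψ , λ t e →
        pre t (from (IH (largestFam-corresponds G) t) (⟪⟫-resp-≈ ψ e Tψ))

  ν-agree : ∀ {Y ψ η ξ} → BodyAgree Y ψ η ξ → SemAgree (νᶠ Y ψ) η ξ
  ν-agree {Y} {ψ} {η} {ξ} IH s = mk⇔
    (λ (G , post , lift g) →
       smallestFam G , smallestFam-post G post , lift (to (smallestFam-corresponds G s) g))
    (λ (F , post , lift m) →
       trace F , (λ t m' → from (IH (trace-corresponds F) t) (post (Γ K t) m')) , lift m)
    where
      smallestFam-post : ∀ G → (∀ t → G t → ⟦ K ⟧ ψ (η [ Y ↦ G ]) t) →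
                         ∀ T → smallestFam G ∋ T → ⟪ K ⟫ ψ (ξ [ Y ↦ smallestFam G ]) T
      smallestFam-post G post T (t , g , e) =
        ⟪⟫-resp-≈ ψ (≈-sym e) (to (IH (smallestFam-corresponds G) t) (post t g))

  semantics-agree : ∀ φ {η ξ} → EnvAgree φ η ξ → SemAgree φ η ξ
  semantics-agree bot agree s = mk⇔ (λ ()) (λ ())
  semantics-agree top agree s = mk⇔ (λ _ → lift (Γ⊆Γ s)) (λ _ → lift tt)
  semantics-agree (atom p) agree s = mk⇔
    (λ (lift sp) → lift (Γ⊆Γ s , λ π (_ , h) → subst (λ u → ℓ u p) (sym h) sp))
    (λ (lift (_ , Γp)) → lift (Γp (fin s []) (tt , refl)))
  semantics-agree (var Z) agree s = mk⇔
    (λ (lift x) → lift (to (agree o-var s) x))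
    (λ (lift x) → lift (from (agree o-var s) x))
  semantics-agree (¬ᶠ φ) agree s = mk⇔
    (λ ¬sφ → lift (Γ⊆Γ s) , λ Γφ → ¬sφ (from IH Γφ))
    (λ (_ , ¬Γφ) sφ → ¬Γφ (to IH sφ))
    where IH = semantics-agree φ (λ o → agree (o-neg o)) s
  semantics-agree (φ ∧ᶠ ψ) agree s =
    semantics-agree φ (λ o → agree (o-∧l o)) s ×-⇔ semantics-agree ψ (λ o → agree (o-∧r o)) s
  semantics-agree (φ ∨ᶠ ψ) agree s =
    semantics-agree φ (λ o → agree (o-∨l o)) s ⊎-⇔ semantics-agree ψ (λ o → agree (o-∨r o)) s
  semantics-agree ([ a ]ᶠ ψ) agree = box-agree (semantics-agree ψ (λ o → agree (o-box o)))
  semantics-agree (⟨ a ⟩ᶠ ψ) agree = diamond-agree (semantics-agree ψ (λ o → agree (o-dia o)))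
  semantics-agree (μᶠ Y ψ) {ξ = ξ} agree = μ-agree {Y} λ G∼F →
    semantics-agree ψ (EnvAgree-update {Y} {ξ = ξ} (λ Z≢Y o → agree (o-μ Z≢Y o)) G∼F)
  semantics-agree (νᶠ Y ψ) {ξ = ξ} agree = ν-agree {Y} λ G∼F →
    semantics-agree ψ (EnvAgree-update {Y} {ξ = ξ} (λ Z≢Y o → agree (o-ν Z≢Y o)) G∼F)

proposition5 : (K : Kripke) (s : Kripke.S K) (φ : Formula (Kripke.A K) (Kripke.AP K)) →
               WF φ → Closed φ → (η : Env K) (ξ : SEnv K) →
               (⟦ K ⟧ φ η s ⇔ ⟪ K ⟫ φ ξ (Γ K s))
proposition5 K s φ _ closed η ξ =
  Correspondence.semantics-agree K φ (λ {b} {Z} o → ⊥-elim (closed b Z o)) s
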